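{- Let $\kappa\ge 3$, let $\pi$ be a projective plane of order $\kappa$, and let $L_1,\ldots,L_{\kappa-1}$ be the complete set of mutually projective Latin squares of order $\kappa$ derived from $\pi$ (as described in the context). Then $L_1$ is resolvable, and in fact $L_1$ is $(\kappa-2)$-fold resolvable.
   Context: A projective plane is a finite geometry (a set of points and a set of lines, each line a subset of the points, any two distinct points on exactly one common line, every line with at least two points) in which any two distinct lines intersect and which has four points no three on a line; its order $\kappa$ is the number of points on a line minus one; it has $n=\kappa^2+\kappa+1$ points and $n$ lines. Its incidence matrix $M=[m_{ij}]$ ($m_{ij}=1$ if line $\ell_i$ contains point $p_j$, else $0$) is put, by labelling points and lines suitably, in the following form. Partition $\{1,\ldots,n\}$ into blocks: block $1=\{1,\ldots,\kappa+1\}$ and block $x=\{(x-1)\kappa+2,\ldots,x\kappa+1\}$ for $2\le x\le\kappa+1$; write $M=[A_{ij}]_{1\le i,j\le\kappa+1}$ with rows and columns so partitioned. The labelling is such that $A_{11}$ has ones exactly in its first row and first column; for $2\le r\le\kappa+1$, $A_{1r}$ has ones exactly in its $r$-th row and $A_{r1}$ has ones exactly in its $r$-th column; $A_{2j}=I_\kappa$ for $2\le j\le\kappa+1$; and $A_{i2}=I_\kappa$ for $3\le i\le\kappa+1$. Then each $A_{ij}$, $2\le i,j\le\kappa+1$, is a $\kappa\times\kappa$ permutation matrix, and the squares derived from $\pi$ are $L_i=\sum_{j=2}^{\kappa+1}(j-1)A_{(i+2)j}$, $1\le i\le\kappa-1$; they are Latin squares of order $\kappa$ on $\{1,\ldots,\kappa\}$,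 pairwise projective (diagonal entries all $1$, and any row of $L_a$ and any row of $L_b$, $a\ne b$, agree in exactly one column). A transversal of a Latin square $N$ of order $\kappa$ is a $\kappa\times\kappa$ matrix $T$ obtained by copying $\kappa$ entries of $N$ that lie in pairwise different rows and pairwise different columns and are pairwise different (hence are $1,\ldots,\kappa$), all other entries of $T$ being $0$. $N$ is resolvable if $N$ is the sum of $\kappa$ transversals. $(\kappa-2)$-fold resolvable means that each of the $\kappa-2$ other squares $L_t$ ($2\le t\le\kappa-1$) yields such a decomposition of $L_1$ into $\kappa$ transversals, the transversal associated with row $r$ of $L_t$ consisting of the entries in which the rows of $L_1$ agree (in the same column) with row $r$ of $L_t$. -}

module Defs where

open import Data.Nat using (ℕ; zero; suc; _+_; _*_; _≤_; _<_; s≤s; z≤n)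
open import Data.Bool using (Bool; true; false; if_then_else_)
open import Data.Fin using (Fin; zero; suc; toℕ; _↑ˡ_; _↑ʳ_; combine; fromℕ<)
open import Data.Product using (Σ; ∃; ∃-syntax; _×_; _,_; proj₁; proj₂)
open import Data.Sum using (_⊎_)
open import Data.Nat.Properties using (≤-trans)
open import Relation.Binary.PropositionalEquality using (_≡_; _≢_)
open import Relation.Nullary using (¬_; does)
import Data.Nat as ℕ
import Data.Fin as F

sumF : ∀ {m} → (Fin m → ℕ) → ℕ
sumF {zero}  f = 0
sumF {suc m} f = f zero + sumF (λ i → f (suc i))

count : ∀ {m} → (Fin m → Bool) → ℕ
count f = sumF (λ i → if f i then 1 else 0)

-- Number of points (and lines): κ² + κ + 1, written as (κ + 1) + κ * κ.
Pts : ℕ → ℕ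
Pts κ = suc κ + κ * κ

-- An incidence matrix: M ℓ p = true iff line ℓ contains point p.
Incidence : ℕ → Set
Incidence κ = Fin (Pts κ) → Fin (Pts κ) → Bool

record IsProjectivePlane (κ : ℕ) (M : Incidence κ) : Set where
  field
    twoPoints : ∀ p q → p ≢ q →
      ∃[ ℓ ] (M ℓ p ≡ true × M ℓ q ≡ true ×
              (∀ ℓ′ → M ℓ′ p ≡ true → M ℓ′ q ≡ true → ℓ′ ≡ ℓ))
    twoOnLine : ∀ ℓ → ∃[ p ] ∃[ q ] (p ≢ q × M ℓ p ≡ true × M ℓ q ≡ true)
    linesMeet : ∀ ℓ ℓ′ → ℓ ≢ ℓ′ → ∃[ p ] (M ℓ p ≡ true × M ℓ′ p ≡ true)
    fourPoints : Σ (Fin 4 → Fin (Pts κ)) λ P → ((∀ (a b : Fin 4) → a ≢ b → P a ≢ P b) ×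
      (∀ ℓ (a b c : Fin 4) → a ≢ b → a ≢ c → b ≢ c →
         ¬ (M ℓ (P a) ≡ true × M ℓ (P b) ≡ true × M ℓ (P c) ≡ true)))
    order : ∀ ℓ → count (M ℓ) ≡ suc κ

-- Index of the a-th element (0-based) of block 1 = {1,…,κ+1}.
idx1 : ∀ κ → Fin (suc κ) → Fin (Pts κ)
idx1 κ a = a ↑ˡ (κ * κ)

-- Index of the c-th element (0-based) of block x+2 (x : Fin κ, 0-based),
-- i.e. 1-based index (x+1)κ + 2 + c.
idxB : ∀ κ → Fin κ → Fin κ → Fin (Pts κ)
idxB κ x c = suc κ ↑ʳ combine x c

-- The labelling conditions on M = [A_ij] (all indices 0-based below;
-- block X (0-based x) among blocks 2..κ+1 is block x+2).
record IsNormalised (κ : ℕ) (M : Incidence κ) : Set where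
  field
    A11 : ∀ a b → (M (idx1 κ a) (idx1 κ b) ≡ true) →
            (toℕ a ≡ 0 ⊎ toℕ b ≡ 0)
    A11′ : ∀ a b → (toℕ a ≡ 0 ⊎ toℕ b ≡ 0) → M (idx1 κ a) (idx1 κ b) ≡ true
    -- A₁ᵣ (r = x+2) has ones exactly in its r-th row (0-based row x+1)
    A1r : ∀ x a c → (M (idx1 κ a) (idxB κ x c) ≡ true) → toℕ a ≡ suc (toℕ x)
    A1r′ : ∀ x a c → toℕ a ≡ suc (toℕ x) → M (idx1 κ a) (idxB κ x c) ≡ true
    -- Aᵣ₁ (r = x+2) has ones exactly in its r-th column
    Ar1 : ∀ x c b → (M (idxB κ x c) (idx1 κ b) ≡ true) → toℕ b ≡ suc (toℕ x)
    Ar1′ : ∀ x c b → toℕ b ≡ suc (toℕ x) → M (idxB κ x c) (idx1 κ b) ≡ true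
    -- A₂ⱼ = I for 2 ≤ j ≤ κ+1
    A2j : ∀ x y c d → toℕ x ≡ 0 → M (idxB κ x c) (idxB κ y d) ≡ true → c ≡ d
    A2j′ : ∀ x y c → toℕ x ≡ 0 → M (idxB κ x c) (idxB κ y c) ≡ true
    -- Aᵢ₂ = I for 3 ≤ i ≤ κ+1
    Ai2 : ∀ x y c d → 1 ≤ toℕ x → toℕ y ≡ 0 →
            M (idxB κ x c) (idxB κ y d) ≡ true → c ≡ d
    Ai2′ : ∀ x y c → 1 ≤ toℕ x → toℕ y ≡ 0 → M (idxB κ x c) (idxB κ y c) ≡ true

-- The block A_{(x+2)(y+2)} as a 0/1 matrix (x, y : Fin κ, 0-based).
Blk : ∀ κ → Incidence κ → Fin κ → Fin κ → Fin κ → Fin κ → ℕ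
Blk κ M x y c d = if M (idxB κ x c) (idxB κ y d) then 1 else 0

Square : ℕ → Set
Square κ = Fin κ → Fin κ → ℕ

-- The derived square L_i = Σ_{j=2}^{κ+1} (j-1) A_{(i+2) j}.
-- Here i : Fin κ is the paper's index i itself (used for 1 ≤ i ≤ κ-1):
-- row block i+2 is 0-based block i, and column block j = y+2 gives weight y+1.
LSq : ∀ κ → Incidence κ → Fin κ → Square κ
LSq κ M i c d = sumF (λ y → suc (toℕ y) * Blk κ M i y c d)

record IsTransversal {κ : ℕ} (N T : Square κ) : Set where
  field
    pos : Fin κ → Fin κ × Fin κ
    rowsDistinct : ∀ a b → a ≢ b → proj₁ (pos a) ≢ proj₁ (pos b)
    colsDistinct : ∀ a b → a ≢ b → proj₂ (pos a) ≢ proj₂ (pos b)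
    valsDistinct : ∀ a b → a ≢ b →
      N (proj₁ (pos a)) (proj₂ (pos a)) ≢ N (proj₁ (pos b)) (proj₂ (pos b))
    copied : ∀ a → T (proj₁ (pos a)) (proj₂ (pos a)) ≡ N (proj₁ (pos a)) (proj₂ (pos a))
    zeroElse : ∀ i j → (∀ a → pos a ≢ (i , j)) → T i j ≡ 0

Resolvable : ∀ {κ} → Square κ → Set
Resolvable {κ} N = Σ (Fin κ → Square κ) λ T → ((∀ r → IsTransversal N (T r)) ×
                           (∀ i j → N i j ≡ sumF (λ r → T r i j)))

AgreeT : ∀ {κ} → Square κ → Square κ → Fin κ → Square κ
AgreeT N L r i j = if does (N i j ℕ.≟ L r j) then N i j else 0

YieldsResolution : ∀ {κ} → Square κ → Square κ → Set
YieldsResolution N L =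
  (∀ r → IsTransversal N (AgreeT N L r)) ×
  (∀ i j → N i j ≡ sumF (λ r → AgreeT N L r i j))

one : ∀ κ → 3 ≤ κ → Fin κ
one κ h = fromℕ< (≤-trans (s≤s (s≤s z≤n)) h)

module Submission where

-- Write I a for the points/lines of block 1 and B x c for the c-th point/line
-- of block x+2 (x = 0, …, κ-1; the derived square L_x lives on line block x+2).
-- The normalisation makes the derived squares geometric: for a
-- line block x ≠ 0, the line B x c meets the "column" {B y d | y} in exactly
-- one point B y d, and then L_x(c, d) = y + 1.  Hence row i of L_s and row r
-- of L_t agree in column j exactly when the lines B s i and B t r meet at a
-- point of column j.
--
-- From
-- these we show that for any two distinct line blocks s, t ≠ 0 the square L_t
-- resolves L_s: the transversal of row r picks, in each row i, the column of
-- the point B s i ∩ B t r, and every cell of L_s lies on exactly one line of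
-- block t.  Theorem 3.4 is the case s = 1, with t = 2 giving resolvability.

open import Defs
open import Data.Nat using (ℕ; _≤_; _+_; zero; suc; s≤s; z≤n)
open import Data.Fin using (Fin; toℕ; zero; suc; _↑ʳ_; combine; splitAt)
open import Data.Product using (_×_; ∃-syntax; _,_; proj₁; proj₂)
open import Data.Sum using (_⊎_; inj₁; inj₂)
open import Data.Bool using (true; false; if_then_else_)
open import Data.Empty using (⊥-elim)
open import Relation.Nullary using (does; yes; no)
open import Relation.Nullary.Decidable using (dec-true; dec-false)
open import Relation.Binary.PropositionalEquality
import Data.Nat as ℕ
import Data.Nat.Properties as NP
import Data.Fin as F
import Data.Fin.Properties as FP

sumF-zero : ∀ {m} (f : Fin m → ℕ) → (∀ y → f y ≡ 0) → sumF f ≡ 0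
sumF-zero {zero}  f z = refl
sumF-zero {suc m} f z rewrite z zero = sumF-zero (λ i → f (suc i)) (λ y → z (suc y))

sumF-single : ∀ {m} (f : Fin m → ℕ) y₀ → (∀ y → y ≢ y₀ → f y ≡ 0) → sumF f ≡ f y₀
sumF-single {suc m} f zero z =
  trans (cong (f zero +_) (sumF-zero (λ i → f (suc i)) (λ y → z (suc y) (λ ()))))
        (NP.+-identityʳ _)
sumF-single {suc m} f (suc y₀) z rewrite z zero (λ ()) =
  sumF-single (λ i → f (suc i)) y₀ (λ y y≢y₀ → z (suc y) (λ e → y≢y₀ (FP.suc-injective e)))

agree-yes : ∀ {x y : ℕ} → x ≡ y → (if does (x ℕ.≟ y) then x else 0) ≡ x
agree-yes {x} {y} x≡y rewrite dec-true (x ℕ.≟ y) x≡y = refl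

agree-no : ∀ {x y : ℕ} → x ≢ y → (if does (x ℕ.≟ y) then x else 0) ≡ 0
agree-no {x} {y} x≢y rewrite dec-false (x ℕ.≟ y) x≢y = refl

yields⇒resolvable : ∀ {κ} {N L : Square κ} → YieldsResolution N L → Resolvable N
yields⇒resolvable {N = N} {L} (transversals , decomposition) =
  AgreeT N L , transversals , decomposition

-- The least element of a non-empty Fin n (used to name the first block).
least : ∀ {n} → Fin n → Fin n
least zero    = zero
least (suc _) = zero

toℕ-least : ∀ {n} (x : Fin n) → toℕ (least x) ≡ 0
toℕ-least zero    = refl
toℕ-least (suc _) = refl

module ProjectivePlane {κ : ℕ} {M : Incidence κ} (pp : IsProjectivePlane κ M) where
  open IsProjectivePlane pp

  common-point-unique : ∀ {ℓ ℓ′ p q} → ℓ ≢ ℓ′ →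
    M ℓ p ≡ true → M ℓ q ≡ true → M ℓ′ p ≡ true → M ℓ′ q ≡ true → p ≡ q
  common-point-unique {ℓ} {ℓ′} {p} {q} ℓ≢ℓ′ ℓp ℓq ℓ′p ℓ′q with p F.≟ q
  ... | yes p≡q = p≡q
  ... | no p≢q with twoPoints p q p≢q
  ...   | _ , _ , _ , unique = ⊥-elim (ℓ≢ℓ′ (trans (unique ℓ ℓp ℓq) (sym (unique ℓ′ ℓ′p ℓ′q))))

module Layout (κ : ℕ) where
  I : Fin (suc κ) → Fin (Pts κ)
  I = idx1 κ

  B : Fin κ → Fin κ → Fin (Pts κ)
  B = idxB κ

  classify : ∀ p → (∃[ a ] p ≡ I a) ⊎ (∃[ x ] ∃[ c ] p ≡ B x c)
  classify p with splitAt (suc κ) p | FP.join-splitAt (suc κ) (κ ℕ.* κ) p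
  ... | inj₁ a | join≡p = inj₁ (a , sym join≡p)
  ... | inj₂ q | join≡p with FP.combine-surjective {κ} {κ} q
  ...   | x , c , combine≡q = inj₂ (x , c , trans (sym join≡p) (cong (suc κ ↑ʳ_) (sym combine≡q)))

  B-injective : ∀ {x y c d} → B x c ≡ B y d → x ≡ y × c ≡ d
  B-injective {x} {y} {c} {d} e =
    FP.combine-injective x c y d (FP.↑ʳ-injective (suc κ) _ _ e)

  I≢B : ∀ {a x c} → I a ≢ B x c
  I≢B {a} {x} {c} e with
    trans (sym (FP.splitAt-↑ˡ (suc κ) a (κ ℕ.* κ)))
          (trans (cong (splitAt (suc κ)) e) (FP.splitAt-↑ʳ (suc κ) (κ ℕ.* κ) (combine x c)))
  ... | ()

  B-blocks-differ : ∀ {x y c d} → toℕ x ≢ toℕ y → B x c ≢ B y d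
  B-blocks-differ x≢y e = x≢y (cong toℕ (proj₁ (B-injective e)))

module NormalisedPlane {κ : ℕ} {M : Incidence κ}
         (pp : IsProjectivePlane κ M) (nm : IsNormalised κ M) where
  open IsProjectivePlane pp using (linesMeet; twoPoints)
  open IsNormalised nm
  open ProjectivePlane pp
  open Layout κ

  meet-in-block₁ : ∀ {x y c d a} → M (B x c) (I a) ≡ true → M (B y d) (I a) ≡ true →
                   toℕ x ≡ toℕ y
  meet-in-block₁ {x} {y} {c} {d} {a} xa ya =
    NP.suc-injective (trans (sym (Ar1 x c a xa)) (Ar1 y d a ya))

  -- Lines of one block are parallel: all of them pass through I (x+1), so two
  -- of them through a common affine point coincide.
  parallel : ∀ {x r r′ y j} → M (B x r) (B y j) ≡ true → M (B x r′) (B y j) ≡ true → r ≡ r′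
  parallel {x} {r} {r′} r∋p r′∋p with r F.≟ r′
  ... | yes r≡r′ = r≡r′
  ... | no r≢r′ = ⊥-elim (I≢B (sym (common-point-unique
          (λ e → r≢r′ (proj₂ (B-injective e)))
          r∋p (Ar1′ x r (suc x) refl) r′∋p (Ar1′ x r′ (suc x) refl))))

  -- Dually, a line B x c contains at most one point of each point block y:
  -- all those points lie on the line I (y+1).
  one-point-per-block : ∀ {x c y j j′} → M (B x c) (B y j) ≡ true → M (B x c) (B y j′) ≡ true →
                        j ≡ j′
  one-point-per-block {x} {c} {y} {j} {j′} ∋j ∋j′ = proj₂ (B-injective (common-point-unique
    (λ e → I≢B (sym e)) ∋j ∋j′ (A1r′ y (suc y) j refl) (A1r′ y (suc y) j′ refl)))

  -- The lines of the first block are the "columns": B z d consists of the points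
  -- B y d for all y (and I 1).  A line B x c with x ≠ 0 meets column d in a
  -- point of the form B y d ...
  column-hit : ∀ {x} → toℕ x ≢ 0 → ∀ c d → ∃[ y ] M (B x c) (B y d) ≡ true
  column-hit {x} x≢0 c d with linesMeet (B x c) (B (least d) d) (B-blocks-differ x≢z)
    where x≢z : toℕ x ≢ toℕ (least d)
          x≢z e = x≢0 (trans e (toℕ-least d))
  ... | p , x∋p , z∋p with classify p
  ...   | inj₁ (a , refl) = ⊥-elim (x≢0 (trans (meet-in-block₁ x∋p z∋p) (toℕ-least d)))
  ...   | inj₂ (y , d′ , refl) with A2j (least d) y d d′ (toℕ-least d) z∋p
  ...     | refl = y , x∋p

  -- ... and this point is unique, since the lines B x c and B z d share at most one point.
  column-hit-unique : ∀ {x c y y′ d} → toℕ x ≢ 0 →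
                      M (B x c) (B y d) ≡ true → M (B x c) (B y′ d) ≡ true → y ≡ y′
  column-hit-unique {x} {c} {y} {y′} {d} x≢0 ∋y ∋y′ = proj₁ (B-injective (common-point-unique
    (B-blocks-differ (λ e → x≢0 (trans e (toℕ-least d))))
    ∋y ∋y′ (A2j′ (least d) y d (toℕ-least d)) (A2j′ (least d) y′ d (toℕ-least d))))

  LSq-entry : ∀ {x c y d} → toℕ x ≢ 0 → M (B x c) (B y d) ≡ true → LSq κ M x c d ≡ suc (toℕ y)
  LSq-entry {x} {c} {y} {d} x≢0 ∋y =
    trans (sumF-single _ y other-terms) (weight (M (B x c) (B y d)) ∋y)
    where
    other-terms : ∀ y′ → y′ ≢ y → suc (toℕ y′) ℕ.* Blk κ M x y′ c d ≡ 0
    other-terms y′ y′≢y with M (B x c) (B y′ d) in ∋y′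
    ... | true  = ⊥-elim (y′≢y (column-hit-unique x≢0 ∋y′ ∋y))
    ... | false = NP.*-zeroʳ (suc (toℕ y′))
    weight : ∀ b → b ≡ true → suc (toℕ y) ℕ.* (if b then 1 else 0) ≡ suc (toℕ y)
    weight .true refl = NP.*-identityʳ _

  same-entry⇒same-block : ∀ {x x′ c c′ y y′ d d′} → toℕ x ≢ 0 → toℕ x′ ≢ 0 →
    M (B x c) (B y d) ≡ true → M (B x′ c′) (B y′ d′) ≡ true →
    LSq κ M x c d ≡ LSq κ M x′ c′ d′ → y ≡ y′
  same-entry⇒same-block x≢0 x′≢0 ∋y ∋y′ e = FP.toℕ-injective (NP.suc-injective
    (trans (sym (LSq-entry x≢0 ∋y)) (trans e (LSq-entry x′≢0 ∋y′))))

  lines-meet-affinely : ∀ {s t} → toℕ s ≢ toℕ t → ∀ i r →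
    ∃[ y ] ∃[ j ] (M (B s i) (B y j) ≡ true × M (B t r) (B y j) ≡ true)
  lines-meet-affinely {s} {t} s≢t i r with linesMeet (B s i) (B t r) (B-blocks-differ s≢t)
  ... | p , s∋p , t∋p with classify p
  ...   | inj₁ (a , refl) = ⊥-elim (s≢t (meet-in-block₁ s∋p t∋p))
  ...   | inj₂ (y , j , refl) = y , j , s∋p , t∋p

  -- Every affine point B y j lies on a line of block t: the line joining it
  -- to I (t+1) is neither in block 1 (by the shape of A₁₁ and A₁ᵣ) nor in
  -- another block (by the shape of Aᵣ₁).
  line-through : ∀ t y j → ∃[ r ] M (B t r) (B y j) ≡ true
  line-through t y j with twoPoints (B y j) (I (suc t)) (λ e → I≢B (sym e))
  ... | ℓ , ℓ∋p , ℓ∋I , _ with classify ℓ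
  ...   | inj₁ (a , refl) with A11 a (suc t) ℓ∋I
  ...     | inj₂ ()
  ...     | inj₁ a≡0 with trans (sym a≡0) (A1r y a j ℓ∋p)
  ...       | ()
  line-through t y j | ℓ , ℓ∋p , ℓ∋I , _ | inj₂ (x , r , refl)
    with FP.toℕ-injective (NP.suc-injective (Ar1 x r (suc t) ℓ∋I))
  ... | refl = r , ℓ∋p

  module Agreement (s t : Fin κ) (s≢0 : toℕ s ≢ 0) (t≢0 : toℕ t ≢ 0) (s≢t : toℕ s ≢ toℕ t) where
    N L : Square κ
    N = LSq κ M s
    L = LSq κ M t

    agreement⇒meeting : ∀ {i r j} → N i j ≡ L r j →
      ∃[ y ] (M (B s i) (B y j) ≡ true × M (B t r) (B y j) ≡ true)
    agreement⇒meeting {i} {r} {j} e with column-hit s≢0 i j | column-hit t≢0 r j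
    ... | y , s∋ | y′ , t∋ with same-entry⇒same-block s≢0 t≢0 s∋ t∋ e
    ...   | refl = y , s∋ , t∋

    module Row (r : Fin κ) where
      crossing : ∀ i → ∃[ y ] ∃[ j ] (M (B s i) (B y j) ≡ true × M (B t r) (B y j) ≡ true)
      crossing i = lines-meet-affinely s≢t i r

      block col : Fin κ → Fin κ
      block i = proj₁ (crossing i)
      col   i = proj₁ (proj₂ (crossing i))

      on-s : ∀ i → M (B s i) (B (block i) (col i)) ≡ true
      on-s i = proj₁ (proj₂ (proj₂ (crossing i)))

      on-t : ∀ i → M (B t r) (B (block i) (col i)) ≡ true
      on-t i = proj₂ (proj₂ (proj₂ (crossing i)))

      same-crossing⇒same-row : ∀ {a b} → block a ≡ block b → col a ≡ col b → a ≡ b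
      same-crossing⇒same-row {a} {b} y≡ j≡ = parallel (on-s a)
        (subst₂ (λ y j → M (B s b) (B y j) ≡ true) (sym y≡) (sym j≡) (on-s b))

      cols-distinct : ∀ a b → a ≢ b → col a ≢ col b
      cols-distinct a b a≢b j≡ = a≢b (same-crossing⇒same-row
        (column-hit-unique t≢0 (on-t a) (subst (λ j → M (B t r) (B (block b) j) ≡ true) (sym j≡) (on-t b)))
        j≡)

      vals-distinct : ∀ a b → a ≢ b → N a (col a) ≢ N b (col b)
      vals-distinct a b a≢b e = a≢b (same-crossing⇒same-row y≡ (one-point-per-block (on-t a)
          (subst (λ y → M (B t r) (B y (col b)) ≡ true) (sym y≡) (on-t b))))
        where
        y≡ : block a ≡ block b
        y≡ = same-entry⇒same-block s≢0 s≢0 (on-s a) (on-s b) e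

      zero-else : ∀ i j → (∀ a → (a , col a) ≢ (i , j)) → AgreeT N L r i j ≡ 0
      zero-else i j avoid with N i j ℕ.≟ L r j
      ... | no  differ = agree-no differ
      ... | yes agree with agreement⇒meeting agree
      ...   | y , s∋ , t∋ = ⊥-elim (avoid i (cong (i ,_) (sym (proj₂ (B-injective
                (common-point-unique (B-blocks-differ s≢t) s∋ (on-s i) t∋ (on-t i)))))))

      transversal : IsTransversal N (AgreeT N L r)
      transversal = record
        { pos          = λ a → a , col a
        ; rowsDistinct = λ a b a≢b → a≢b
        ; colsDistinct = cols-distinct
        ; valsDistinct = vals-distinct
        ; copied       = λ a → agree-yes (trans (LSq-entry s≢0 (on-s a)) (sym (LSq-entry t≢0 (on-t a))))
        ; zeroElse     = zero-else
        }

    -- Each cell (i, j) of L_s lies in exactly one transversal: the one of the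
    -- unique line of block t through the point of B s i in column j.
    decomposition : ∀ i j → N i j ≡ sumF (λ r → AgreeT N L r i j)
    decomposition i j with column-hit s≢0 i j
    ... | y , s∋ with line-through t y j
    ...   | r₀ , t∋ = sym (trans (sumF-single _ r₀ other-rows)
                (agree-yes (trans (LSq-entry s≢0 s∋) (sym (LSq-entry t≢0 t∋)))))
      where
      other-rows : ∀ r → r ≢ r₀ → AgreeT N L r i j ≡ 0
      other-rows r r≢r₀ with N i j ℕ.≟ L r j
      ... | no  differ = agree-no differ
      ... | yes agree with agreement⇒meeting agree
      ...   | y′ , s∋′ , t∋′ with column-hit-unique s≢0 s∋ s∋′
      ...     | refl = ⊥-elim (r≢r₀ (parallel t∋′ t∋))

    yields : YieldsResolution N L
    yields = Row.transversal , decomposition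

-- The squares L_t
-- (t ≥ 2) live on line blocks x = t different from x = 1 (that of L₁) and
-- from x = 0; resolvability is witnessed by L₂.
theorem34 : (κ : ℕ) (h : 3 ≤ κ) (M : Incidence κ) →
    IsProjectivePlane κ M → IsNormalised κ M →
    Resolvable (LSq κ M (one κ h)) ×
    ((t : Fin κ) → 2 ≤ toℕ t →
    YieldsResolution (LSq κ M (one κ h)) (LSq κ M t))
theorem34 κ h M pp nm = yields⇒resolvable (resolves two 2≤two) , resolves
  where
  open NormalisedPlane pp nm using (module Agreement)

  toℕ-one : toℕ (one κ h) ≡ 1
  toℕ-one = FP.toℕ-fromℕ< (NP.≤-trans (s≤s (s≤s z≤n)) h)

  resolves : (t : Fin κ) → 2 ≤ toℕ t → YieldsResolution (LSq κ M (one κ h)) (LSq κ M t)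
  resolves t 2≤t = Agreement.yields (one κ h) t
    (subst (_≢ 0) (sym toℕ-one) (λ ()))
    (NP.>⇒≢ (NP.≤-trans (s≤s z≤n) 2≤t))
    (subst (_≢ toℕ t) (sym toℕ-one) (NP.<⇒≢ 2≤t))

  two : Fin κ
  two = F.fromℕ< h

  2≤two : 2 ≤ toℕ two
  2≤two = NP.≤-reflexive (sym (FP.toℕ-fromℕ< h))
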